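{- Let $C_4\ge 1$ be the constant of the following fact: for identical length-$L$ strings $X,Y$ and a matching $(i_1,j_1),\dots,(i_M,j_M)\in[L]^2$ with $i_t>j_t$, $X[i_t]=Y[j_t]$, $i_1<\dots<i_M$, $j_1<\dots<j_M$, a CGK random walk started from any state $(\hat I,\hat J)$ with $\hat I-\hat J\ge C_4(L-M)$ misses $(L,L)$ with probability at least $0.5$. Now let $X,Y$ be two identical length-$L$ strings over $\Sigma$ and assume there is a size-$M$ matching $(i_1,j_1),\dots,(i_M,j_M)\in[L]^2$ such that either $i_t>j_t$ for all $t\in[M]$ or $i_t<j_t$ for all $t\in[M]$; $X[i_t]=Y[j_t]$ for all $t$; and $i_1<\dots<i_M$, $j_1<\dots<j_M$. Let $\rho=C_4\cdot(L-M)$ and let $(\hat I,\hat J)$ be any state with $|\hat I-\hat J|\ge\rho$. Then a CGK random walk on $X,Y$ started from $(\hat I,\hat J)$ misses $(L,L)$ with probability at least $0.5$.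
   Context: CGK random walk on a pair of strings $X,Y$ (each extended beyond its end by infinitely many copies of a fixed character): a state is a pair $(p,q)$ of pointers into $X$ and $Y$. At each step $t=1,2,\dots$ an independent uniformly random function $r_t:\Sigma\to\{0,1\}$ is drawn and the state is updated by $p\gets p+r_t(X[p])$, $q\gets q+r_t(Y[q])$ (the same $r_t$ for both strings). The walk misses $(L,L)$ if it never passes through the state $(L,L)$.
   Formalization: The constant C₄ takes only rational values, both as the constant of the fact about matchings with $i_t>j_t$ and in the corollary. -}

module Defs where

open import Data.Bool using (Bool; true; false; not; _∧_; _∨_; if_then_else_)
open import Data.Nat as ℕ using (ℕ; zero; suc; _+_; _*_; _∸_; _≤_; _<_; _≡ᵇ_; _<ᵇ_)
open import Data.Fin as Fin using (Fin; zero; suc)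
open import Data.Vec using (Vec; lookup)
open import Data.List using (List; []; _∷_; length; filterᵇ; concatMap; map)
open import Data.Product using (_×_; _,_)
open import Data.Integer using (+_)
open import Data.Rational using (ℚ; _/_)
open import Relation.Binary.PropositionalEquality using (_≡_)
open import Relation.Nullary using (yes; no)

-- Alphabet Σ = Fin k.  Extended alphabet Σ ∪ {pad} = Fin (suc k):
-- `zero` is the fixed padding character, `suc c` is the letter c ∈ Σ.
Char⁺ : ℕ → Set
Char⁺ k = Fin (suc k)

-- Strings are 1-indexed: X[1], …, X[L].  Position p of the extended string
-- reads X[p] if 1 ≤ p ≤ L and the padding character otherwise.
charAt : ∀ {k L} → Vec (Fin k) L → ℕ → Char⁺ k
charAt {k} {L} X zero = zero
charAt {k} {L} X (suc p) with p ℕ.<? L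
... | yes p<L = suc (lookup X (Fin.fromℕ< p<L))
... | no  _   = zero

RandFun : ℕ → Set
RandFun k = Char⁺ k → Bool

State : Set
State = ℕ × ℕ

bit : Bool → ℕ
bit true  = 1
bit false = 0

step : ∀ {k L} → Vec (Fin k) L → Vec (Fin k) L → RandFun k → State → State
step X Y r (p , q) = (p + bit (r (charAt X p))) , (q + bit (r (charAt Y q)))

isState : State → State → Bool
isState (p , q) (a , b) = (p ≡ᵇ a) ∧ (q ≡ᵇ b)

visits : ∀ {k L} → Vec (Fin k) L → Vec (Fin k) L → State → State → List (RandFun k) → Bool
visits X Y target s []       = isState s target
visits X Y target s (r ∷ rs) = isState s target ∨ visits X Y target (step X Y r s) rs

allBoolFuns : (n : ℕ) → List (Fin n → Bool)
allBoolFuns zero    = (λ ()) ∷ []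
allBoolFuns (suc n) = concatMap (λ f → ((λ { zero → true  ; (suc i) → f i })) ∷
                                       ((λ { zero → false ; (suc i) → f i })) ∷ []) (allBoolFuns n)

-- All sequences (r₁,…,r_T) of random functions (each exactly once; uniform measure).
allSeqs : (k T : ℕ) → List (List (RandFun k))
allSeqs k zero    = [] ∷ []
allSeqs k (suc T) = concatMap (λ r → map (r ∷_) (allSeqs k T)) (allBoolFuns (suc k))

missCount : ∀ {k L} → Vec (Fin k) L → Vec (Fin k) L → State → ℕ → ℕ
missCount {k} {L} X Y s T = length (filterᵇ (λ rs → not (visits X Y (L , L) s rs)) (allSeqs k T))

-- Pr[walk misses (L,L)] ≥ 1/2.  The event "misses (L,L)" is the decreasing
-- intersection over T of "misses (L,L) within the first T steps", so by
-- continuity of measure its probability is ≥ 1/2 iff every finite-horizon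
-- miss probability missCount T / 2^((k+1)T) is ≥ 1/2.
MissesWithProbAtLeastHalf : ∀ {k L} → Vec (Fin k) L → Vec (Fin k) L → State → Set
MissesWithProbAtLeastHalf {k} X Y s =
  ∀ (T : ℕ) → length (allSeqs k T) ≤ 2 * missCount X Y s T

record IsMatching {k L : ℕ} (X Y : Vec (Fin k) L) (M : ℕ) (i j : Fin M → ℕ) : Set where
  field
    i-range : ∀ t → 1 ≤ i t × i t ≤ L
    j-range : ∀ t → 1 ≤ j t × j t ≤ L
    match   : ∀ t → charAt X (i t) ≡ charAt Y (j t)
    i-incr  : ∀ s t → s Fin.< t → i s < i t
    j-incr  : ∀ s t → s Fin.< t → j s < j t

ℕ→ℚ : ℕ → ℚ
ℕ→ℚ n = + n / 1

CGKFact : ℚ → Set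
CGKFact C₄ =
  ∀ (k L : ℕ) (X Y : Vec (Fin k) L) → X ≡ Y →
  ∀ (M : ℕ) (i j : Fin M → ℕ) → IsMatching X Y M i j →
  (∀ t → j t < i t) →
  ∀ (Î Ĵ : ℕ) → 1 ≤ Î → 1 ≤ Ĵ →
  C₄ Data.Rational.* ℕ→ℚ (L ∸ M) Data.Rational.≤ ℕ→ℚ Î Data.Rational.- ℕ→ℚ Ĵ →
  MissesWithProbAtLeastHalf X Y (Î , Ĵ)

{-# OPTIONS --safe #-}
module Submission where

-- Swapping the two strings together with the two pointers maps CGK walks to CGK walks
-- driven by the same random functions, and (L , L) is fixed by the swap.  Since X = Y,
-- a state with Ĵ − Î ≥ ρ, or a matching with i_t < j_t, is thus reduced to the case
-- covered by the defining fact of C₄.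

open import Defs
open import Data.Nat using (ℕ; _≤_; _<_; _∸_; _*_; _≡ᵇ_)
open import Data.Fin using (Fin)
open import Data.Vec using (Vec)
open import Data.Sum using (_⊎_; inj₁; inj₂)
open import Data.Product using (_,_; swap)
open import Data.Rational using (ℚ; 1ℚ; ∣_∣; -_) renaming (_≤_ to _≤ℚ_; _*_ to _*ℚ_; _-_ to _-ℚ_)
open import Data.Rational.Properties using (∣p∣≡p∨∣p∣≡-p; +-0-abelianGroup)
open import Algebra.Properties.AbelianGroup +-0-abelianGroup using (⁻¹-anti-homo‿-)
open import Data.Bool using (Bool; T; T?; _∨_; not)
open import Data.Bool.Properties using (∧-comm)
open import Data.List using (List; []; _∷_; length; filterᵇ)
open import Data.List.Properties using (filter-≐)
open import Relation.Binary.PropositionalEquality using (_≡_; _≗_; refl; sym; cong; cong₂; subst)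

≤∣p∣⇒≤p⊎≤-p : ∀ {c p} → c ≤ℚ ∣ p ∣ → c ≤ℚ p ⊎ c ≤ℚ - p
≤∣p∣⇒≤p⊎≤-p {c} {p} c≤∣p∣ with ∣p∣≡p∨∣p∣≡-p p
... | inj₁ ∣p∣≡p  = inj₁ (subst (c ≤ℚ_) ∣p∣≡p c≤∣p∣)
... | inj₂ ∣p∣≡-p = inj₂ (subst (c ≤ℚ_) ∣p∣≡-p c≤∣p∣)

≤∣p-q∣⇒≤p-q⊎≤q-p : ∀ {c} p q → c ≤ℚ ∣ p -ℚ q ∣ → c ≤ℚ p -ℚ q ⊎ c ≤ℚ q -ℚ p
≤∣p-q∣⇒≤p-q⊎≤q-p {c} p q c≤∣p-q∣ with ≤∣p∣⇒≤p⊎≤-p c≤∣p-q∣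
... | inj₁ c≤p-q    = inj₁ c≤p-q
... | inj₂ c≤-[p-q] = inj₂ (subst (c ≤ℚ_) (⁻¹-anti-homo‿- p q) c≤-[p-q])

filterᵇ-cong : ∀ {A : Set} {f g : A → Bool} → (∀ x → f x ≡ g x) → filterᵇ f ≗ filterᵇ g
filterᵇ-cong {f = f} {g} f≗g =
  filter-≐ (λ x → T? (f x)) (λ x → T? (g x))
    ((λ {x} → subst T (f≗g x)) , (λ {x} → subst T (sym (f≗g x))))

isState-swap : ∀ s target → isState s target ≡ isState (swap s) (swap target)
isState-swap (a , b) (t , u) = ∧-comm (a ≡ᵇ t) (b ≡ᵇ u)

visits-swap : ∀ {k L} (X Y : Vec (Fin k) L) target s (rs : List (RandFun k)) →
  visits X Y target s rs ≡ visits Y X (swap target) (swap s) rs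
visits-swap X Y target s        []       = isState-swap s target
visits-swap X Y target s@(_ , _) (r ∷ rs) =
  cong₂ _∨_ (isState-swap s target) (visits-swap X Y target (step X Y r s) rs)

missCount-swap : ∀ {k L} (X Y : Vec (Fin k) L) s T → missCount X Y s T ≡ missCount Y X (swap s) T
missCount-swap {k} {L} X Y s T =
  cong length (filterᵇ-cong (λ rs → cong not (visits-swap X Y (L , L) s rs)) (allSeqs k T))

misses-swap : ∀ {k L} (X Y : Vec (Fin k) L) s →
  MissesWithProbAtLeastHalf X Y s → MissesWithProbAtLeastHalf Y X (swap s)
misses-swap {k} X Y s misses T =
  subst (λ n → length (allSeqs k T) ≤ 2 * n) (missCount-swap X Y s T) (misses T)

IsMatching-swap : ∀ {k L} {X Y : Vec (Fin k) L} {M i j} → IsMatching X Y M i j → IsMatching Y X M j i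
IsMatching-swap m = record
  { i-range = j-range ; j-range = i-range ; match = λ t → sym (match t)
  ; i-incr  = j-incr  ; j-incr  = i-incr }
  where open IsMatching m

corollary3p10 : ∀ (C₄ : ℚ) → 1ℚ ≤ℚ C₄ → CGKFact C₄ →
    ∀ (k L : ℕ) (X Y : Vec (Fin k) L) → X ≡ Y →
    ∀ (M : ℕ) (i j : Fin M → ℕ) → IsMatching X Y M i j →
    ((∀ t → j t < i t) ⊎ (∀ t → i t < j t)) →
    ∀ (Î Ĵ : ℕ) → 1 ≤ Î → 1 ≤ Ĵ →
    C₄ *ℚ ℕ→ℚ (L ∸ M) ≤ℚ ∣ ℕ→ℚ Î -ℚ ℕ→ℚ Ĵ ∣ →
    MissesWithProbAtLeastHalf X Y (Î , Ĵ)
corollary3p10 C₄ _ fact k L X .X refl M i j m dir Î Ĵ 1≤Î 1≤Ĵ ρ≤∣Î-Ĵ∣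
  with ≤∣p-q∣⇒≤p-q⊎≤q-p (ℕ→ℚ Î) (ℕ→ℚ Ĵ) ρ≤∣Î-Ĵ∣ | dir
... | inj₁ ρ≤Î-Ĵ | inj₁ j<i = fact k L X X refl M i j m j<i Î Ĵ 1≤Î 1≤Ĵ ρ≤Î-Ĵ
... | inj₁ ρ≤Î-Ĵ | inj₂ i<j = fact k L X X refl M j i (IsMatching-swap m) i<j Î Ĵ 1≤Î 1≤Ĵ ρ≤Î-Ĵ
... | inj₂ ρ≤Ĵ-Î | inj₁ j<i =
  misses-swap X X (Ĵ , Î) (fact k L X X refl M i j m j<i Ĵ Î 1≤Ĵ 1≤Î ρ≤Ĵ-Î)
... | inj₂ ρ≤Ĵ-Î | inj₂ i<j =
  misses-swap X X (Ĵ , Î) (fact k L X X refl M j i (IsMatching-swap m) i<j Ĵ Î 1≤Ĵ 1≤Î ρ≤Ĵ-Î)
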